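{- The forest dimension of a digraph equals the number of its undominated knots.
   Context: For a finite loopless digraph $\Gamma$: a diverging forest is a digraph without circuits with all indegrees $\le1$, its roots being the indegree-0 vertices; a maximum out forest is a spanning diverging forest of $\Gamma$ with the maximum number of arcs; the forest dimension is the number of roots of a maximum out forest. $w$ is reachable from $z$ if $w=z$ or there is a directed path from $z$ to $w$. An undominated knot is a nonempty $K\subseteq V(\Gamma)$ whose vertices are mutually reachable and such that no arc goes from a vertex outside $K$ to a vertex of $K$. -}

module Defs where

open import Data.Nat using (ℕ; zero; suc; _+_; _≤_)
open import Data.Nat.Base using (_≡ᵇ_)
open import Data.Bool using (Bool; true; false; if_then_else_)
open import Data.Fin using (Fin; zero; suc)
open import Data.Fin.Subset using (Subset; _∈_; _∉_)
open import Data.Product using (∃; _×_)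
open import Data.List using (List; length)
open import Data.List.Relation.Unary.Unique.Propositional using (Unique)
import Data.List.Membership.Propositional as LM
open import Relation.Nullary using (¬_)
open import Relation.Binary.PropositionalEquality using (_≡_)
open import Relation.Binary.Construct.Closure.Transitive using (TransClosure)
open import Relation.Binary.Construct.Closure.ReflexiveTransitive using (Star)
open import Function.Bundles using (_⇔_)

Digraph : ℕ → Set
Digraph n = Fin n → Fin n → Bool

Loopless : ∀ {n} → Digraph n → Set
Loopless E = ∀ i → E i i ≡ false

Arc : ∀ {n} → Digraph n → Fin n → Fin n → Set
Arc E i j = E i j ≡ true

count : ∀ {n} → (Fin n → Bool) → ℕ
count {zero}  f = 0
count {suc n} f = (if f zero then 1 else 0) + count (λ i → f (suc i))

sumFin : ∀ {n} → (Fin n → ℕ) → ℕ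
sumFin {zero}  f = 0
sumFin {suc n} f = f zero + sumFin (λ i → f (suc i))

indegree : ∀ {n} → Digraph n → Fin n → ℕ
indegree F j = count (λ i → F i j)

numArcs : ∀ {n} → Digraph n → ℕ
numArcs F = sumFin (λ i → count (λ j → F i j))

numRoots : ∀ {n} → Digraph n → ℕ
numRoots F = count (λ j → indegree F j ≡ᵇ 0)

SubArcs : ∀ {n} → Digraph n → Digraph n → Set
SubArcs F E = ∀ i j → Arc F i j → Arc E i j

NoCircuit : ∀ {n} → Digraph n → Set
NoCircuit F = ∀ v → ¬ TransClosure (Arc F) v v

IsDivergingForest : ∀ {n} → Digraph n → Set
IsDivergingForest F = NoCircuit F × (∀ j → indegree F j ≤ 1)

IsSpanningOutForest : ∀ {n} → Digraph n → Digraph n → Set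
IsSpanningOutForest E F = SubArcs F E × IsDivergingForest F

IsMaximumOutForest : ∀ {n} → Digraph n → Digraph n → Set
IsMaximumOutForest E F =
  IsSpanningOutForest E F ×
  (∀ F' → IsSpanningOutForest E F' → numArcs F' ≤ numArcs F)

Reachable : ∀ {n} → Digraph n → Fin n → Fin n → Set
Reachable E = Star (Arc E)

IsUndominatedKnot : ∀ {n} → Digraph n → Subset n → Set
IsUndominatedKnot E K =
  (∃ λ v → v ∈ K) ×
  (∀ v w → v ∈ K → w ∈ K → Reachable E v w) ×
  (∀ u v → u ∉ K → v ∈ K → ¬ Arc E u v)

NumUndominatedKnots : ∀ {n} → Digraph n → ℕ → Set
NumUndominatedKnots {n} E k =
  ∃ λ (ks : List (Subset n)) →
    Unique ks × (∀ K → (K LM.∈ ks) ⇔ IsUndominatedKnot E K) × length ks ≡ k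

{-# OPTIONS --safe #-}
module Submission where

-- Let F be a maximum out forest of E and r a root of F. Every E-ancestor w of r is an
-- F-descendant of r: otherwise some arc a → b of E enters the tree of r from outside it.
-- Replacing the F-arc into b by a → b yields a spanning diverging forest. If b = r this adds
-- an arc, which is impossible; so b ≠ r, the new forest is again maximum, r is still one of
-- its roots, and its tree at r has lost b, so the argument repeats.
-- Consequently the E-ancestors of r form an undominated knot, and two roots never lie in the
-- same knot. Conversely, an undominated knot is closed under E-predecessors, so following
-- F-arcs backwards from any of its vertices leads to a root of F inside it, and the knot equals
-- the set of E-ancestors of that root. Hence r ↦ (E-ancestors of r) is a bijection from the
-- roots of F to the undominated knots of E.

open import Defs

open import Data.Bool using (Bool; true; false; if_then_else_)
import Data.Bool.Properties as Bool
open import Data.Fin using (Fin; zero; suc; punchIn)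
open import Data.Fin.Induction using (spo-wellFounded)
open import Data.Fin.Properties using (_≟_; punchInᵢ≢i; any?)
open import Data.Fin.Subset using (Subset; _∈_)
open import Data.Fin.Subset.Properties using (_∈?_; ⊆-antisym)
open import Data.List using (List; map; filter; tabulate; allFin; length)
open import Data.List.Properties using (length-map)
import Data.List.Membership.Propositional as List
open import Data.List.Membership.Propositional.Properties
  using (∈-map⁺; ∈-map⁻; ∈-filter⁺; ∈-filter⁻; ∈-allFin)
open import Data.List.Relation.Unary.All as All using (All; []; _∷_)
import Data.List.Relation.Unary.All.Properties as Allₚ
open import Data.List.Relation.Unary.AllPairs using ([]; _∷_)
open import Data.List.Relation.Unary.Unique.Propositional using (Unique)
open import Data.List.Relation.Unary.Unique.Propositional.Properties using (allFin⁺; filter⁺)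
open import Data.Nat using (ℕ; zero; suc; _+_; _≤_; _<_; z≤n; s≤s)
import Data.Nat as ℕ
open import Data.Nat.Induction using (<-wellFounded)
open import Data.Nat.Properties
  using (≤-reflexive; ≤-trans; ≤-antisym; ≤-<-trans; <⇒≱; n≢0⇒n>0; m≤n⇒m≤1+n;
         +-comm; +-identityʳ; +-cancelʳ-≡; +-0-commutativeMonoid; +-commutativeSemigroup)
open import Data.Product using (∃; ∃₂; _×_; _,_; proj₁; proj₂)
open import Data.Sum using (_⊎_; inj₁; inj₂)
open import Data.Vec using () renaming (tabulate to tabulateᵛ)
open import Data.Vec.Properties using (lookup∘tabulate; []=⇒lookup; lookup⇒[]=)
open import Function using (_∘_)
open import Function.Bundles using (mk⇔; Equivalence)
open import Induction.WellFounded using (Acc; acc)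
open import Relation.Binary using (Rel; IsStrictPartialOrder)
open import Relation.Binary.Construct.Closure.ReflexiveTransitive as Star using (Star; ε; _◅_; _◅◅_)
open import Relation.Binary.Construct.Closure.Transitive using (TransClosure; [_]; _∷_; _++_)
open import Relation.Binary.PropositionalEquality
open import Relation.Nullary using (¬_; Dec; does; yes; no; contradiction)
open import Relation.Nullary.Decidable
  using (dec-true; dec-false; map′; decidable-stable; toWitness; fromWitness; ⌊_⌋; _×-dec_; _⊎-dec_; ¬?)
open import Relation.Unary using (Pred; Decidable)

open import Algebra.Properties.CommutativeMonoid.Sum +-0-commutativeMonoid
  using (sum; sum-remove; sum-cong-≗; ∑-comm)
open import Algebra.Properties.CommutativeSemigroup +-commutativeSemigroup using (xy∙z≈zy∙x)

count≤n : ∀ {n} (f : Fin n → Bool) → count f ≤ n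
count≤n {zero}  f = z≤n
count≤n {suc n} f with f zero
... | true  = s≤s (count≤n (f ∘ suc))
... | false = m≤n⇒m≤1+n (count≤n (f ∘ suc))

count-cong : ∀ {n} {f g : Fin n → Bool} → f ≗ g → count f ≡ count g
count-cong {zero}      f≗g = refl
count-cong {suc n} {f} f≗g =
  cong₂ _+_ (cong (λ b → if b then 1 else 0) (f≗g zero)) (count-cong (f≗g ∘ suc))

count>0 : ∀ {n} (f : Fin n → Bool) {x} → f x ≡ true → 0 < count f
count>0 f {zero}  fx≡true rewrite fx≡true = s≤s z≤n
count>0 f {suc x} fx≡true with f zero
... | true  = s≤s z≤n
... | false = count>0 (f ∘ suc) fx≡true

count≡0 : ∀ {n} {f : Fin n → Bool} → (∀ x → f x ≡ false) → count f ≡ 0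
count≡0 {zero}  f≡false = refl
count≡0 {suc n} f≡false rewrite f≡false zero = count≡0 (f≡false ∘ suc)

count-singleton : ∀ {n} (a : Fin n) → count (λ i → does (i ≟ a)) ≡ 1
count-singleton {suc n} zero = cong suc (count≡0 {n} λ _ → refl)
count-singleton (suc a)      = count-singleton a

count-⊆ : ∀ {n p q} {P : Pred (Fin n) p} {Q : Pred (Fin n) q} (P? : Decidable P) (Q? : Decidable Q) →
          (∀ {x} → P x → Q x) → count (does ∘ P?) ≤ count (does ∘ Q?)
count-⊆ {zero}  P? Q? P⊆Q = z≤n
count-⊆ {suc n} P? Q? P⊆Q with P? zero | Q? zero
... | yes _  | yes _  = s≤s (count-⊆ (P? ∘ suc) (Q? ∘ suc) P⊆Q)
... | yes p₀ | no ¬q₀ = contradiction (P⊆Q p₀) ¬q₀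
... | no _   | yes _  = m≤n⇒m≤1+n (count-⊆ (P? ∘ suc) (Q? ∘ suc) P⊆Q)
... | no _   | no _   = count-⊆ (P? ∘ suc) (Q? ∘ suc) P⊆Q

count-⊂ : ∀ {n p q} {P : Pred (Fin n) p} {Q : Pred (Fin n) q} (P? : Decidable P) (Q? : Decidable Q) →
          (∀ {x} → P x → Q x) → ∀ {b} → Q b → ¬ P b → count (does ∘ P?) < count (does ∘ Q?)
count-⊂ P? Q? P⊆Q {zero} qb ¬pb with P? zero | Q? zero
... | yes pb | _      = contradiction pb ¬pb
... | no _   | yes _  = s≤s (count-⊆ (P? ∘ suc) (Q? ∘ suc) P⊆Q)
... | no _   | no ¬qb = contradiction qb ¬qb
count-⊂ P? Q? P⊆Q {suc b} qb ¬pb with P? zero | Q? zero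
... | yes _  | yes _  = s≤s (count-⊂ (P? ∘ suc) (Q? ∘ suc) P⊆Q qb ¬pb)
... | yes p₀ | no ¬q₀ = contradiction (P⊆Q p₀) ¬q₀
... | no _   | yes _  = m≤n⇒m≤1+n (count-⊂ (P? ∘ suc) (Q? ∘ suc) P⊆Q qb ¬pb)
... | no _   | no _   = count-⊂ (P? ∘ suc) (Q? ∘ suc) P⊆Q qb ¬pb

sumFin≡sum : ∀ {n} (f : Fin n → ℕ) → sumFin f ≡ sum f
sumFin≡sum {zero}  f = refl
sumFin≡sum {suc n} f = cong (f zero +_) (sumFin≡sum (f ∘ suc))

count≡sum : ∀ {n} (f : Fin n → Bool) → count f ≡ sum (λ i → if f i then 1 else 0)
count≡sum {zero}  f = refl
count≡sum {suc n} f = cong ((if f zero then 1 else 0) +_) (count≡sum (f ∘ suc))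

sum-update : ∀ {n} {f g : Fin n → ℕ} {b} → (∀ j → j ≢ b → f j ≡ g j) → sum f + g b ≡ sum g + f b
sum-update {suc n} {f} {g} {b} f≡g = begin
  sum f + g b                     ≡⟨ cong (_+ g b) (sum-remove f) ⟩
  f b + sum (f ∘ punchIn b) + g b ≡⟨ cong (λ s → f b + s + g b) (sum-cong-≗ {n} λ j → f≡g _ (punchInᵢ≢i b j)) ⟩
  f b + sum (g ∘ punchIn b) + g b ≡⟨ xy∙z≈zy∙x (f b) (sum (g ∘ punchIn b)) (g b) ⟩
  g b + sum (g ∘ punchIn b) + f b ≡⟨ cong (_+ f b) (sum-remove g) ⟨
  sum g + f b                     ∎
  where open ≡-Reasoning

numArcs≡sum-indegree : ∀ {n} (F : Digraph n) → numArcs F ≡ sum (indegree F)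
numArcs≡sum-indegree F = begin
  numArcs F                                      ≡⟨ sumFin≡sum (λ i → count (F i)) ⟩
  sum (λ i → count (F i))                        ≡⟨ sum-cong-≗ (λ i → count≡sum (F i)) ⟩
  sum (λ i → sum (λ j → if F i j then 1 else 0)) ≡⟨ ∑-comm (λ i j → if F i j then 1 else 0) ⟩
  sum (λ j → sum (λ i → if F i j then 1 else 0)) ≡⟨ sum-cong-≗ (λ j → count≡sum (λ i → F i j)) ⟨
  sum (indegree F)                               ∎
  where open ≡-Reasoning

numArcs-update-column : ∀ {n} {F G : Digraph n} {b} → (∀ i j → j ≢ b → F i j ≡ G i j) →
                        numArcs F + indegree G b ≡ numArcs G + indegree F b
numArcs-update-column {F = F} {G} {b} F≡G = begin
  numArcs F + indegree G b        ≡⟨ cong (_+ indegree G b) (numArcs≡sum-indegree F) ⟩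
  sum (indegree F) + indegree G b ≡⟨ sum-update (λ j j≢b → count-cong (λ i → F≡G i j j≢b)) ⟩
  sum (indegree G) + indegree F b ≡⟨ cong (_+ indegree F b) (numArcs≡sum-indegree G) ⟨
  numArcs G + indegree F b        ∎
  where open ≡-Reasoning

unique-map⁺ : ∀ {a b p} {A : Set a} {B : Set b} {P : Pred A p} {f : A → B} {xs} →
              (∀ {x y} → P x → P y → f x ≡ f y → x ≡ y) → All P xs → Unique xs → Unique (map f xs)
unique-map⁺ inj []         []           = []
unique-map⁺ inj (px ∷ pxs) (x∉xs ∷ xs!) =
  Allₚ.map⁺ (All.zipWith (λ (py , x≢y) → x≢y ∘ inj px py) (pxs , x∉xs)) ∷ unique-map⁺ inj pxs xs!

length-filter-tabulate : ∀ {a p} {A : Set a} {P : Pred A p} (P? : Decidable P) {n} (f : Fin n → A) →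
                         length (filter P? (tabulate f)) ≡ count (does ∘ P? ∘ f)
length-filter-tabulate P? {zero}  f = refl
length-filter-tabulate P? {suc n} f with does (P? (f zero))
... | true  = cong suc (length-filter-tabulate P? (f ∘ suc))
... | false = length-filter-tabulate P? (f ∘ suc)

module _ {a ℓ} {A : Set a} {R : Rel A ℓ} where

  Star-last : ∀ {x y} → Star R x y → x ≡ y ⊎ ∃ λ p → Star R x p × R p y
  Star-last ε = inj₁ refl
  Star-last (e ◅ s) with Star-last s
  ... | inj₁ refl          = inj₂ (_ , ε , e)
  ... | inj₂ (p , s′ , e′) = inj₂ (p , e ◅ s′ , e′)

  Star-crossing : ∀ {p} {P : Pred A p} → Decidable P → ∀ {x y} → Star R x y → ¬ P x → P y →
                  ∃₂ λ u v → R u v × ¬ P u × P v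
  Star-crossing P? ε ¬px py = contradiction py ¬px
  Star-crossing P? (_◅_ {j = z} e s) ¬px py with P? z
  ... | yes pz = _ , _ , e , ¬px , pz
  ... | no ¬pz = Star-crossing P? s ¬pz py

  ⁺-uncons : ∀ {x y} → TransClosure R x y → ∃ λ z → R x z × Star R z y
  ⁺-uncons [ e ]   = _ , e , ε
  ⁺-uncons (e ∷ t) with ⁺-uncons t
  ... | _ , e′ , s = _ , e , e′ ◅ s

  ⁺-cons : ∀ {x y z} → R x y → Star R y z → TransClosure R x z
  ⁺-cons e ε        = [ e ]
  ⁺-cons e (e′ ◅ s) = e ∷ ⁺-cons e′ s

module BoundedReachability {n} (E : Digraph n) (v : Fin n) where

  Within : ℕ → Fin n → Set
  Within zero    w = v ≡ w
  Within (suc k) w = Within k w ⊎ ∃ λ u → Within k u × Arc E u w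

  within? : ∀ k → Decidable (Within k)
  within? zero    w = v ≟ w
  within? (suc k) w = within? k w ⊎-dec any? (λ u → within? k u ×-dec (E u w Bool.≟ true))

  within-start : ∀ k → Within k v
  within-start zero    = refl
  within-start (suc k) = inj₁ (within-start k)

  within⇒reachable : ∀ k {w} → Within k w → Reachable E v w
  within⇒reachable zero    refl                = ε
  within⇒reachable (suc k) (inj₁ w∈)           = within⇒reachable k w∈
  within⇒reachable (suc k) (inj₂ (u , u∈ , e)) = within⇒reachable k u∈ ◅◅ e ◅ ε

  Closed : ℕ → Set
  Closed k = ∀ {u w} → Within k u → Arc E u w → Within k w

  closed⇒complete : ∀ {k} → Closed k → ∀ {w} → Reachable E v w → Within k w
  closed⇒complete {k} closed = go (within-start k)
    where
    go : ∀ {u w} → Within k u → Star (Arc E) u w → Within k w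
    go u∈ ε       = u∈
    go u∈ (e ◅ s) = go (closed u∈ e) s

  closed-suc : ∀ {k} → Closed k → Closed (suc k)
  closed-suc closed u∈ e = inj₁ (closed (shrink u∈) e)
    where
    shrink : ∀ {u} → Within (suc _) u → Within _ u
    shrink (inj₁ u∈)             = u∈
    shrink (inj₂ (_ , u′∈ , e′)) = closed u′∈ e′

  size : ℕ → ℕ
  size k = count (does ∘ within? k)

  -- Until Within k is closed under arcs, every step adds a vertex; as size k ≤ n,
  -- this forces Within n to be closed.
  closed-or-growing : ∀ k → Closed k ⊎ k < size k
  closed-or-growing zero = inj₂ (count>0 (does ∘ within? 0) (dec-true (within? 0 v) refl))
  closed-or-growing (suc k) with closed-or-growing k
  ... | inj₁ closed = inj₁ (closed-suc closed)
  ... | inj₂ k<size with any? (λ w → within? (suc k) w ×-dec ¬? (within? k w))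
  ...   | yes (w , new , ¬old) =
          inj₂ (≤-<-trans k<size (count-⊂ (within? k) (within? (suc k)) inj₁ new ¬old))
  ...   | no ¬new = inj₁ (closed-suc λ u∈ e → stable (inj₂ (_ , u∈ , e)))
    where
    stable : ∀ {w} → Within (suc k) w → Within k w
    stable {w} w∈ = decidable-stable (within? k w) λ ¬old → ¬new (w , w∈ , ¬old)

  closed-at-n : Closed n
  closed-at-n with closed-or-growing n
  ... | inj₁ closed = closed
  ... | inj₂ n<size = contradiction (count≤n (does ∘ within? n)) (<⇒≱ n<size)

reachable? : ∀ {n} (E : Digraph n) → ∀ v w → Dec (Reachable E v w)
reachable? {n} E v w = map′ (within⇒reachable n) (closed⇒complete closed-at-n) (within? n w)
  where open BoundedReachability E v

rehang : ∀ {n} → Digraph n → Fin n → Fin n → Digraph n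
rehang F a b i j = if does (j ≟ b) then does (i ≟ a) else F i j

module _ {n} {F : Digraph n} {a b : Fin n} where

  private
    G : Digraph n
    G = rehang F a b

  rehang-arc⁻ : ∀ {i j} → Arc G i j → (Arc F i j × j ≢ b) ⊎ (i ≡ a × j ≡ b)
  rehang-arc⁻ {i} {j} e with j ≟ b | i ≟ a
  ... | no j≢b  | _       = inj₁ (e , j≢b)
  ... | yes j≡b | yes i≡a = inj₂ (i≡a , j≡b)
  rehang-arc⁻ {i} {j} () | yes _ | no _

  rehang-off : ∀ {i j} → j ≢ b → G i j ≡ F i j
  rehang-off {j = j} j≢b rewrite dec-false (j ≟ b) j≢b = refl

  rehang-indegree-off : ∀ {j} → j ≢ b → indegree G j ≡ indegree F j
  rehang-indegree-off j≢b = count-cong {n} λ i → rehang-off {i} j≢b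

  rehang-indegree-target : indegree G b ≡ 1
  rehang-indegree-target rewrite dec-true (b ≟ b) refl = count-singleton a

  rehang-numArcs : numArcs F + 1 ≡ numArcs G + indegree F b
  rehang-numArcs = begin
    numArcs F + 1            ≡⟨ cong (numArcs F +_) rehang-indegree-target ⟨
    numArcs F + indegree G b ≡⟨ numArcs-update-column (λ _ _ j≢b → sym (rehang-off j≢b)) ⟩
    numArcs G + indegree F b ∎
    where open ≡-Reasoning

  rehang-path : ∀ {x y} → Star (Arc G) x y → Star (Arc F) x y ⊎ (Star (Arc F) x a × Star (Arc F) b y)
  rehang-path ε = inj₁ ε
  rehang-path (e ◅ s) with rehang-arc⁻ e | rehang-path s
  ... | inj₁ (e′ , _)      | inj₁ s′        = inj₁ (e′ ◅ s′)
  ... | inj₁ (e′ , _)      | inj₂ (s₁ , s₂) = inj₂ (e′ ◅ s₁ , s₂)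
  ... | inj₂ (refl , refl) | inj₁ s′        = inj₂ (ε , s′)
  ... | inj₂ (refl , refl) | inj₂ (_ , s₂)  = inj₂ (ε , s₂)

  rehang-reachable : ∀ {x y} → ¬ Reachable F x a → Reachable G x y → Reachable F x y
  rehang-reachable x↛a s with rehang-path s
  ... | inj₁ s′       = s′
  ... | inj₂ (s₁ , _) = contradiction s₁ x↛a

  rehang-unreachable-target : ∀ {x} → ¬ Reachable F x a → x ≢ b → ¬ Reachable G x b
  rehang-unreachable-target x↛a x≢b s with Star-last s
  ... | inj₁ x≡b          = x≢b x≡b
  ... | inj₂ (p , s′ , e) with rehang-arc⁻ e
  ...   | inj₁ (_ , b≢b)  = b≢b refl
  ...   | inj₂ (refl , _) = x↛a (rehang-reachable x↛a s′)

  rehang-noCircuit : NoCircuit F → ¬ Reachable F b a → NoCircuit G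
  rehang-noCircuit acyclic b↛a v cycle with ⁺-uncons cycle
  ... | _ , e , s with rehang-arc⁻ e | rehang-path s
  ...   | inj₁ (e′ , _)      | inj₁ s′        = acyclic v (⁺-cons e′ s′)
  ...   | inj₁ (e′ , _)      | inj₂ (s₁ , s₂) = b↛a (s₂ ◅◅ e′ ◅ s₁)
  ...   | inj₂ (refl , refl) | inj₁ s′        = b↛a s′
  ...   | inj₂ (refl , refl) | inj₂ (s₁ , _)  = b↛a s₁

  rehang-isSpanningOutForest : ∀ {E} → IsSpanningOutForest E F → Arc E a b → ¬ Reachable F b a →
                               IsSpanningOutForest E G
  rehang-isSpanningOutForest (F⊆E , acyclic , indegree≤1) a→b b↛a =
    G⊆E , rehang-noCircuit acyclic b↛a , indegreeG≤1
    where
    G⊆E : SubArcs G _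
    G⊆E i j e with rehang-arc⁻ e
    ... | inj₁ (e′ , _)      = F⊆E i j e′
    ... | inj₂ (refl , refl) = a→b
    indegreeG≤1 : ∀ j → indegree G j ≤ 1
    indegreeG≤1 j = by-cases (j ≟ b)
      where
      by-cases : Dec (j ≡ b) → indegree G j ≤ 1
      by-cases (yes refl) = ≤-reflexive rehang-indegree-target
      by-cases (no j≢b)   = subst (_≤ 1) (sym (rehang-indegree-off j≢b)) (indegree≤1 j)

module _ {n} {F : Digraph n} where

  indegree≡0⇒¬arc : ∀ {r p} → indegree F r ≡ 0 → ¬ Arc F p r
  indegree≡0⇒¬arc r-root p→r = <⇒≱ (count>0 (λ i → F i _) p→r) (≤-reflexive r-root)

  reaches-source⇒≡ : ∀ {r x} → indegree F r ≡ 0 → Reachable F x r → x ≡ r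
  reaches-source⇒≡ r-root s with Star-last s
  ... | inj₁ x≡r         = x≡r
  ... | inj₂ (_ , _ , e) = contradiction e (indegree≡0⇒¬arc r-root)

  ⁺-isStrictPartialOrder : NoCircuit F → IsStrictPartialOrder _≡_ (TransClosure (Arc F))
  ⁺-isStrictPartialOrder acyclic = record
    { isEquivalence = isEquivalence
    ; irrefl        = λ { refl → acyclic _ }
    ; trans         = _++_
    ; <-resp-≈      = resp₂ _
    }

  reachable-from-source : NoCircuit F → ∀ v → ∃ λ r → indegree F r ≡ 0 × Reachable F r v
  reachable-from-source acyclic v = go (spo-wellFounded (⁺-isStrictPartialOrder acyclic) v)
    where
    go : ∀ {v} → Acc (TransClosure (Arc F)) v → ∃ λ r → indegree F r ≡ 0 × Reachable F r v
    go {v} (acc earlier) with any? (λ p → F p v Bool.≟ true)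
    ... | no no-arc = v , count≡0 (λ p → Bool.¬-not (λ p→v → no-arc (p , p→v))) , ε
    ... | yes (p , p→v) with go (earlier [ p→v ])
    ...   | r , r-source , r→p = r , r-source , r→p ◅◅ p→v ◅ ε

module _ {n} {E F : Digraph n} (F-max : IsMaximumOutForest E F) {r a b : Fin n}
         (r-root : indegree F r ≡ 0) (a→b : Arc E a b)
         (r↛a : ¬ Reachable F r a) (r→b : Reachable F r b) where

  private
    G-forest : IsSpanningOutForest E (rehang F a b)
    G-forest = rehang-isSpanningOutForest (proj₁ F-max) a→b (λ b→a → r↛a (r→b ◅◅ b→a))

  rehang-target≢root : b ≢ r
  rehang-target≢root refl = <⇒≱ more-arcs (proj₂ F-max _ G-forest)
    where
    more-arcs : numArcs F < numArcs (rehang F a b)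
    more-arcs = ≤-reflexive (begin
      suc (numArcs F)                       ≡⟨ +-comm 1 (numArcs F) ⟩
      numArcs F + 1                         ≡⟨ rehang-numArcs {F = F} {a} {b} ⟩
      numArcs (rehang F a b) + indegree F r ≡⟨ cong (numArcs (rehang F a b) +_) r-root ⟩
      numArcs (rehang F a b) + 0            ≡⟨ +-identityʳ _ ⟩
      numArcs (rehang F a b)                ∎)
      where open ≡-Reasoning

  rehang-isMaximumOutForest : IsMaximumOutForest E (rehang F a b)
  rehang-isMaximumOutForest =
    G-forest , λ F′ F′-forest → ≤-trans (proj₂ F-max F′ F′-forest) (≤-reflexive same-arcs)
    where
    indegree-b : indegree F b ≡ 1
    indegree-b = ≤-antisym (proj₂ (proj₂ (proj₁ F-max)) b)
                   (n≢0⇒n>0 λ b-root → rehang-target≢root (sym (reaches-source⇒≡ b-root r→b)))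
    same-arcs : numArcs F ≡ numArcs (rehang F a b)
    same-arcs = +-cancelʳ-≡ _ _ _
      (trans (rehang-numArcs {F = F} {a} {b}) (cong (numArcs (rehang F a b) +_) indegree-b))

maximum-root-reaches-ancestors : ∀ {n} {E F : Digraph n} {r w} → IsMaximumOutForest E F →
                                  indegree F r ≡ 0 → Reachable E w r → Reachable F r w
maximum-root-reaches-ancestors {n} {E} {F} {r} {w} F-max r-root w→r = go F-max r-root (<-wellFounded _)
  where
  descendants : Digraph n → ℕ
  descendants G = count (does ∘ reachable? G r)
  go : ∀ {G} → IsMaximumOutForest E G → indegree G r ≡ 0 → Acc _<_ (descendants G) → Reachable G r w
  go {G} G-max r-root (acc smaller) with reachable? G r w
  ... | yes r→w = r→w
  ... | no r↛w with Star-crossing (reachable? G r) w→r r↛w ε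
  ...   | a , b , a→b , r↛a , r→b =
          contradiction (rehang-reachable r↛a (go H-max H-root (smaller fewer))) r↛w
    where
    r≢b : r ≢ b
    r≢b = rehang-target≢root G-max r-root a→b r↛a r→b ∘ sym
    H-max : IsMaximumOutForest E (rehang G a b)
    H-max = rehang-isMaximumOutForest G-max r-root a→b r↛a r→b
    H-root : indegree (rehang G a b) r ≡ 0
    H-root = trans (rehang-indegree-off {F = G} r≢b) r-root
    fewer : descendants (rehang G a b) < descendants G
    fewer = count-⊂ (reachable? (rehang G a b) r) (reachable? G r) (rehang-reachable r↛a) r→b
              (rehang-unreachable-target r↛a r≢b)

module _ {n} (E : Digraph n) where

  ancestors : Fin n → Subset n
  ancestors r = tabulateᵛ λ w → ⌊ reachable? E w r ⌋

  ∈-ancestors⁺ : ∀ {w r} → Reachable E w r → w ∈ ancestors r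
  ∈-ancestors⁺ {w} w→r =
    lookup⇒[]= w _ (trans (lookup∘tabulate _ w) (Equivalence.to Bool.T-≡ (fromWitness w→r)))

  ∈-ancestors⁻ : ∀ {w r} → w ∈ ancestors r → Reachable E w r
  ∈-ancestors⁻ {w} {r} w∈ =
    toWitness {a? = reachable? E w r} (Equivalence.from Bool.T-≡ (trans (sym (lookup∘tabulate _ w)) ([]=⇒lookup w∈)))

  knot-closed-backward : ∀ {K v w} → IsUndominatedKnot E K → Reachable E w v → v ∈ K → w ∈ K
  knot-closed-backward knot ε v∈K = v∈K
  knot-closed-backward {K} {w = w} knot (e ◅ s) v∈K =
    decidable-stable (w ∈? K) λ w∉K → proj₂ (proj₂ knot) _ _ w∉K (knot-closed-backward knot s v∈K) e

  knot≡ancestors : ∀ {K r} → IsUndominatedKnot E K → r ∈ K → K ≡ ancestors r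
  knot≡ancestors knot r∈K = ⊆-antisym
    (λ w∈K → ∈-ancestors⁺ (proj₁ (proj₂ knot) _ _ w∈K r∈K))
    (λ w∈ → knot-closed-backward knot (∈-ancestors⁻ w∈) r∈K)

  knot-contains-source : ∀ {F K} → SubArcs F E → NoCircuit F → IsUndominatedKnot E K →
                         ∃ λ r → indegree F r ≡ 0 × r ∈ K
  knot-contains-source F⊆E acyclic knot with proj₁ knot
  ... | v , v∈K with reachable-from-source acyclic v
  ...   | r , r-source , r→v = r , r-source , knot-closed-backward knot (Star.map (F⊆E _ _) r→v) v∈K

  module _ {F} (F-max : IsMaximumOutForest E F) where

    ancestors-isUndominatedKnot : ∀ {r} → indegree F r ≡ 0 → IsUndominatedKnot E (ancestors r)
    ancestors-isUndominatedKnot r-root =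
      (_ , ∈-ancestors⁺ ε) ,
      (λ v w v∈ w∈ → ∈-ancestors⁻ v∈ ◅◅
         Star.map (proj₁ (proj₁ F-max) _ _) (maximum-root-reaches-ancestors F-max r-root (∈-ancestors⁻ w∈))) ,
      (λ u v u∉ v∈ u→v → u∉ (∈-ancestors⁺ (u→v ◅ ∈-ancestors⁻ v∈)))

    ancestors-injective : ∀ {r₁ r₂} → indegree F r₁ ≡ 0 → indegree F r₂ ≡ 0 →
                          ancestors r₁ ≡ ancestors r₂ → r₁ ≡ r₂
    ancestors-injective {r₁} {r₂} r₁-root r₂-root eq =
      sym (reaches-source⇒≡ r₁-root (maximum-root-reaches-ancestors F-max r₂-root r₁→r₂))
      where
      r₁→r₂ : Reachable E r₁ r₂
      r₁→r₂ = ∈-ancestors⁻ (subst (r₁ ∈_) eq (∈-ancestors⁺ ε))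

proposition6 : ∀ (n : ℕ) (E : Digraph n) → Loopless E →
    ∀ (F : Digraph n) → IsMaximumOutForest E F →
    NumUndominatedKnots E (numRoots F)
proposition6 n E _ F F-max =
  map (ancestors E) roots ,
  unique-map⁺ (ancestors-injective E F-max) (Allₚ.all-filter root? (allFin n)) (filter⁺ root? (allFin⁺ n)) ,
  (λ K → mk⇔ knot-sound (knot-complete K)) ,
  trans (length-map (ancestors E) roots) (length-filter-tabulate root? (λ j → j))
  where
  root? : Decidable (λ j → indegree F j ≡ 0)
  root? j = indegree F j ℕ.≟ 0
  roots : List (Fin n)
  roots = filter root? (allFin n)
  knot-sound : ∀ {K} → K List.∈ map (ancestors E) roots → IsUndominatedKnot E K
  knot-sound K∈ with ∈-map⁻ (ancestors E) K∈
  ... | r , r∈roots , refl = ancestors-isUndominatedKnot E F-max (proj₂ (∈-filter⁻ root? {xs = allFin n} r∈roots))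
  knot-complete : ∀ K → IsUndominatedKnot E K → K List.∈ map (ancestors E) roots
  knot-complete K knot with knot-contains-source E (proj₁ (proj₁ F-max)) (proj₁ (proj₂ (proj₁ F-max))) knot
  ... | r , r-root , r∈K =
    subst (List._∈ map (ancestors E) roots) (sym (knot≡ancestors E knot r∈K))
          (∈-map⁺ (ancestors E) (∈-filter⁺ root? (∈-allFin r) r-root))
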